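{- Let $(A_n(q))_{n\ge0}$ be polynomials with real coefficients, $A_n$ of degree $n$, and define $$\widehat A_n(a,b,c,d,q)=(a+bq)^nA_n\!\left(\frac{c+dq}{a+bq}\right),\qquad n\ge0.$$ If $(A_n(q))_{n\ge0}$ is coefficientwise Hankel-totally positive of order $r$ in $q$, then $(\widehat A_n(a,b,c,d,q))_{n\ge0}$ is coefficientwise Hankel-totally positive of order $r$ in $(a,b,c,d,q)$.
   Context: A matrix with polynomial entries is coefficientwise totally positive of order $r$ in a set of indeterminates if all its minors of size at most $r$ are polynomials in these indeterminates with nonnegative coefficients. A sequence $(a_n)_{n\ge0}$ is coefficientwise Hankel-totally positive of order $r$ if the Hankel matrix $[a_{i+j}]_{i,j\ge0}$ is coefficientwise totally positive of order $r$. -}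

module Defs where

open import Level using (Level; _⊔_) renaming (suc to lsuc)
open import Algebra.Bundles using (CommutativeRing)
open import Relation.Binary.Structures using (IsTotalOrder)
open import Data.Nat as ℕ using (ℕ; zero; suc; _∸_)
open import Data.Fin as Fin using (Fin; zero; suc; punchIn)
open import Data.List using (List; []; _∷_; map; upTo)
open import Data.List.Relation.Unary.All using (All)
open import Data.Product using (_×_)
open import Relation.Nullary using (¬_)

-- A (totally) ordered commutative ring; the real numbers are an instance.
record OrderedCommRing (c ℓ₁ ℓ₂ : Level) : Set (lsuc (c ⊔ ℓ₁ ⊔ ℓ₂)) where
  field
    commutativeRing : CommutativeRing c ℓ₁
  open CommutativeRing commutativeRing public
  field
    _≤_          : Carrier → Carrier → Set ℓ₂
    isTotalOrder : IsTotalOrder _≈_ _≤_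
    +-monoˡ-≤    : ∀ {x y} z → x ≤ y → (x + z) ≤ (y + z)
    *-nonneg     : ∀ {x y} → 0# ≤ x → 0# ≤ y → 0# ≤ (x * y)

module Poly {c ℓ₁ ℓ₂} (O : OrderedCommRing c ℓ₁ ℓ₂) where
  open OrderedCommRing O using (Carrier; _≈_; _≤_; _+_; _*_; -_; 0#; 1#)

  -- Polynomials in k indeterminates x₀,…,x_{k-1} over the ring, as nested
  -- coefficient lists: Poly (suc k) = polynomials in x₀ with coefficients in
  -- Poly k (in x₁,…,x_k).  Entry i of a list is the coefficient of x₀^i.
  Poly : ℕ → Set c
  Poly zero    = Carrier
  Poly (suc k) = List (Poly k)

  zeroP : ∀ k → Poly k
  zeroP zero    = 0#
  zeroP (suc k) = []

  constP : ∀ k → Carrier → Poly k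
  constP zero    x = x
  constP (suc k) x = constP k x ∷ []

  oneP : ∀ k → Poly k
  oneP k = constP k 1#

  addP : ∀ k → Poly k → Poly k → Poly k
  addP zero    x        y        = x + y
  addP (suc k) []       q        = q
  addP (suc k) (x ∷ xs) []       = x ∷ xs
  addP (suc k) (x ∷ xs) (y ∷ ys) = addP k x y ∷ addP (suc k) xs ys

  negP : ∀ k → Poly k → Poly k
  negP zero    x        = - x
  negP (suc k) []       = []
  negP (suc k) (x ∷ xs) = negP k x ∷ negP (suc k) xs

  mutual
    mulP : ∀ k → Poly k → Poly k → Poly k
    mulP zero    x        y = x * y
    mulP (suc k) []       q = []
    mulP (suc k) (x ∷ xs) q = addP (suc k) (scaleP k x q) (zeroP k ∷ mulP (suc k) xs q)

    scaleP : ∀ k → Poly k → Poly (suc k) → Poly (suc k)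
    scaleP k x []       = []
    scaleP k x (y ∷ ys) = mulP k x y ∷ scaleP k x ys

  powP : ∀ k → Poly k → ℕ → Poly k
  powP k p zero    = oneP k
  powP k p (suc n) = mulP k p (powP k p n)

  var : ∀ k → Fin k → Poly k
  var (suc k) zero    = zeroP k ∷ oneP k ∷ []
  var (suc k) (suc i) = var k i ∷ []

  NonNeg : ∀ k → Poly k → Set (c ⊔ ℓ₂)
  NonNeg zero    x = Level.Lift c (0# ≤ x)
  NonNeg (suc k) p = All (NonNeg k) p

  sumFin : ∀ k m → (Fin m → Poly k) → Poly k
  sumFin k zero    f = zeroP k
  sumFin k (suc m) f = addP k (f zero) (sumFin k m (λ i → f (suc i)))

  altSign : ∀ k → ℕ → Poly k → Poly k
  altSign k zero    p = p
  altSign k (suc n) p = negP k (altSign k n p)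

  det : ∀ k m → (Fin m → Fin m → Poly k) → Poly k
  det k zero    M = oneP k
  det k (suc m) M = sumFin k (suc m) λ j →
    altSign k (Fin.toℕ j)
      (mulP k (M zero j) (det k m (λ r s → M (suc r) (punchIn j s))))

  StrictlyIncreasing : ∀ {m} → (Fin m → ℕ) → Set
  StrictlyIncreasing I = ∀ i j → i Fin.< j → I i ℕ.< I j

  CoeffTP : ∀ k → ℕ → (ℕ → ℕ → Poly k) → Set (c ⊔ ℓ₂)
  CoeffTP k r M = ∀ m → m ℕ.≤ r → (I J : Fin m → ℕ) →
    StrictlyIncreasing I → StrictlyIncreasing J →
    NonNeg k (det k m (λ s t → M (I s) (J t)))

  HankelTP : ∀ k → ℕ → (ℕ → Poly k) → Set (c ⊔ ℓ₂)
  HankelTP k r a = CoeffTP k r (λ i j → a (i ℕ.+ j))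

  coeff : Poly 1 → ℕ → Carrier
  coeff []       n       = 0#
  coeff (x ∷ xs) zero    = x
  coeff (x ∷ xs) (suc n) = coeff xs n

  HasDegree : ℕ → Poly 1 → Set ℓ₁
  HasDegree n p = (∀ k → n ℕ.< k → coeff p k ≈ 0#) × ¬ (coeff p n ≈ 0#)

  -- Â_n(a,b,c,d,q) = (a+bq)^n A_n((c+dq)/(a+bq))
  --               = Σ_{k=0}^{n} [q^k]A_n · (c+dq)^k (a+bq)^(n-k)
  -- variables: a = x₀, b = x₁, c = x₂, d = x₃, q = x₄
  hat : (ℕ → Poly 1) → ℕ → Poly 5
  hat A n = sumFin 5 (suc n) λ k →
    mulP 5 (constP 5 (coeff (A n) (Fin.toℕ k)))
      (mulP 5 (powP 5 cdq (Fin.toℕ k)) (powP 5 abq (n ∸ Fin.toℕ k)))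
    where
      a b c' d q : Poly 5
      a  = var 5 zero
      b  = var 5 (suc zero)
      c' = var 5 (suc (suc zero))
      d  = var 5 (suc (suc (suc zero)))
      q  = var 5 (suc (suc (suc (suc zero))))
      abq cdq : Poly 5
      abq = addP 5 a (mulP 5 b q)
      cdq = addP 5 c' (mulP 5 d q)

-- With X = a + bq and Y = c + dq, Âₙ = Xⁿ Aₙ(Y/X) = Σᵢ [qⁱ]Aₙ · Yⁱ Xⁿ⁻ⁱ is the
-- homogenisation of Aₙ in degree n.  Homogenisation is additive and, under
-- degree bounds, multiplicative: H_{N+M}(PQ) = H_N(P) H_M(Q) when deg P ≤ N and
-- deg Q ≤ M.  In a Hankel minor with rows I and columns J the (s,t) entry has
-- degree ≤ I s + J t, so Laplace expansion shows that the corresponding minor of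
-- (Âₙ) is the homogenisation, in degree ΣI + ΣJ, of the minor of (Aₙ).  Finally,
-- homogenising a polynomial with nonnegative coefficients in X and Y, which have
-- nonnegative coefficients, gives nonnegative coefficients.
module Submission where

open import Defs

open import Level using (Level; _⊔_; lift)
open import Algebra.Bundles using (CommutativeRing; CommutativeSemigroup)
open import Algebra.Structures using (IsCommutativeRing)
import Algebra.Properties.CommutativeSemigroup as CommutativeSemigroupProperties
import Algebra.Properties.Ring as RingProperties
import Algebra.Solver.Ring.NaturalCoefficients.Default
open import Data.Fin using (Fin; zero; suc; toℕ; punchIn)
open import Data.Fin.Patterns using (0F; 1F; 2F; 3F; 4F)
open import Data.List using (List; []; _∷_)
open import Data.List.Relation.Unary.All using ([]; _∷_)
open import Data.Nat as ℕ using (ℕ; zero; suc; _∸_)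
open import Data.Nat.Properties using (+-0-commutativeMonoid; +-commutativeSemigroup)
open import Data.Product using (_,_; proj₁)
open import Data.Sum using (inj₁; inj₂)
open import Data.Unit.Polymorphic using (⊤; tt)
open import Data.Vec.Functional using (removeAt)
open import Function using (_∘_)
open import Relation.Binary.Structures using (IsEquivalence; IsTotalOrder)
open import Relation.Binary.PropositionalEquality as ≡ using (_≡_)
import Relation.Binary.Reasoning.Setoid as ≈-Reasoning

open import Algebra.Properties.CommutativeMonoid.Sum +-0-commutativeMonoid using (sum; sum-remove)
open import Algebra.Properties.CommutativeSemigroup +-commutativeSemigroup
  using () renaming (interchange to +-interchange)

lookupOr : ∀ {a} {A : Set a} → A → List A → ℕ → A
lookupOr z []       i       = z
lookupOr z (x ∷ xs) zero    = x
lookupOr z (x ∷ xs) (suc i) = lookupOr z xs i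

module _ {c ℓ₁ ℓ₂ : Level} (O : OrderedCommRing c ℓ₁ ℓ₂) where
  open Poly O
  private module K = OrderedCommRing O

  -- Lists are compared after padding with zeros, so trailing zero
  -- coefficients do not matter.
  record Coeffwise {A : Set c} (_∼_ : A → A → Set ℓ₁) (z : A) (xs ys : List A) : Set ℓ₁ where
    constructor coeffwise
    field coeff-∼ : ∀ i → lookupOr z xs i ∼ lookupOr z ys i
  open Coeffwise

  Eq : ∀ k → Poly k → Poly k → Set ℓ₁
  Eq zero    = K._≈_
  Eq (suc k) = Coeffwise (Eq k) (zeroP k)

  IsPolyRing : ℕ → Set (c ⊔ ℓ₁)
  IsPolyRing k = IsCommutativeRing (Eq k) (addP k) (mulP k) (negP k) (zeroP k) (oneP k)

  module ListRing (k : ℕ) (isCR : IsPolyRing k) where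
    coeffRing : CommutativeRing c ℓ₁
    coeffRing = record { isCommutativeRing = isCR }
    open CommutativeRing coeffRing hiding (isCommutativeRing)
    open RingProperties ring using (-0#≈0#)

    infix  4 _≋_
    infixl 6 _⊕_
    infixl 7 _⊛_
    infixl 10 _‼_

    _≋_ : Poly (suc k) → Poly (suc k) → Set ℓ₁
    _≋_ = Eq (suc k)

    _⊕_ _⊛_ : Poly (suc k) → Poly (suc k) → Poly (suc k)
    _⊕_ = addP (suc k)
    _⊛_ = mulP (suc k)

    ⊝_ : Poly (suc k) → Poly (suc k)
    ⊝_ = negP (suc k)

    scale : Poly k → Poly (suc k) → Poly (suc k)
    scale = scaleP k

    _‼_ : Poly (suc k) → ℕ → Poly k
    _‼_ = lookupOr 0#

    ≋-by : ∀ {xs ys} (f : ℕ → Poly k) →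
      (∀ i → xs ‼ i ≈ f i) → (∀ i → ys ‼ i ≈ f i) → xs ≋ ys
    ≋-by f p q = coeffwise λ i → trans (p i) (sym (q i))

    ≋-refl : ∀ {xs} → xs ≋ xs
    ≋-refl = coeffwise λ i → refl

    ≋-sym : ∀ {xs ys} → xs ≋ ys → ys ≋ xs
    ≋-sym (coeffwise e) = coeffwise λ i → sym (e i)

    ≋-trans : ∀ {xs ys zs} → xs ≋ ys → ys ≋ zs → xs ≋ zs
    ≋-trans (coeffwise e) (coeffwise f) = coeffwise λ i → trans (e i) (f i)

    ∷-cong : ∀ {x y xs ys} → x ≈ y → xs ≋ ys → x ∷ xs ≋ y ∷ ys
    ∷-cong e (coeffwise es) = coeffwise λ { zero → e ; (suc i) → es i }

    0∷-≋[] : ∀ {xs} → xs ≋ [] → 0# ∷ xs ≋ []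
    0∷-≋[] (coeffwise es) = coeffwise λ { zero → refl ; (suc i) → es i }

    ‼-⊕ : ∀ xs ys i → (xs ⊕ ys) ‼ i ≈ xs ‼ i + ys ‼ i
    ‼-⊕ []       ys       i       = sym (+-identityˡ _)
    ‼-⊕ (x ∷ xs) []       i       = sym (+-identityʳ _)
    ‼-⊕ (x ∷ xs) (y ∷ ys) zero    = refl
    ‼-⊕ (x ∷ xs) (y ∷ ys) (suc i) = ‼-⊕ xs ys i

    ‼-⊝ : ∀ xs i → (⊝ xs) ‼ i ≈ - (xs ‼ i)
    ‼-⊝ []       i       = sym -0#≈0#
    ‼-⊝ (x ∷ xs) zero    = refl
    ‼-⊝ (x ∷ xs) (suc i) = ‼-⊝ xs i

    ‼-scale : ∀ a xs i → scale a xs ‼ i ≈ a * xs ‼ i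
    ‼-scale a []       i       = sym (zeroʳ a)
    ‼-scale a (x ∷ xs) zero    = refl
    ‼-scale a (x ∷ xs) (suc i) = ‼-scale a xs i

    ‼-⊕≈ : ∀ xs ys {a b} i → xs ‼ i ≈ a → ys ‼ i ≈ b → (xs ⊕ ys) ‼ i ≈ a + b
    ‼-⊕≈ xs ys i p q = trans (‼-⊕ xs ys i) (+-cong p q)

    ⊕-cong : ∀ {xs xs′ ys ys′} → xs ≋ xs′ → ys ≋ ys′ → xs ⊕ ys ≋ xs′ ⊕ ys′
    ⊕-cong {xs} {xs′} {ys} {ys′} (coeffwise e) (coeffwise f) =
      ≋-by (λ i → xs′ ‼ i + ys′ ‼ i) (λ i → ‼-⊕≈ xs ys i (e i) (f i)) (‼-⊕ xs′ ys′)

    ⊕-assoc : ∀ xs ys zs → (xs ⊕ ys) ⊕ zs ≋ xs ⊕ (ys ⊕ zs)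
    ⊕-assoc xs ys zs = ≋-by (λ i → xs ‼ i + (ys ‼ i + zs ‼ i))
      (λ i → trans (‼-⊕≈ (xs ⊕ ys) zs i (‼-⊕ xs ys i) refl) (+-assoc _ _ _))
      (λ i → ‼-⊕≈ xs (ys ⊕ zs) i refl (‼-⊕ ys zs i))

    ⊕-comm : ∀ xs ys → xs ⊕ ys ≋ ys ⊕ xs
    ⊕-comm xs ys = ≋-by (λ i → xs ‼ i + ys ‼ i) (‼-⊕ xs ys)
      (λ i → trans (‼-⊕ ys xs i) (+-comm _ _))

    ⊕-identityʳ : ∀ xs → xs ⊕ [] ≋ xs
    ⊕-identityʳ xs = ≋-by (xs ‼_) (λ i → trans (‼-⊕ xs [] i) (+-identityʳ _)) (λ i → refl)

    ≋-isEquivalence : IsEquivalence _≋_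
    ≋-isEquivalence = record { refl = ≋-refl ; sym = ≋-sym ; trans = ≋-trans }

    ⊕-commutativeSemigroup : CommutativeSemigroup c ℓ₁
    ⊕-commutativeSemigroup = record
      { isCommutativeSemigroup = record
        { isSemigroup = record
          { isMagma = record { isEquivalence = ≋-isEquivalence ; ∙-cong = ⊕-cong }
          ; assoc   = ⊕-assoc }
        ; comm = ⊕-comm } }
    open CommutativeSemigroupProperties ⊕-commutativeSemigroup
      using () renaming (interchange to ⊕-interchange; x∙yz≈y∙xz to ⊕-left-comm)

    ⊝-cong : ∀ {xs ys} → xs ≋ ys → ⊝ xs ≋ ⊝ ys
    ⊝-cong {xs} {ys} (coeffwise e) = ≋-by (λ i → - (ys ‼ i))
      (λ i → trans (‼-⊝ xs i) (-‿cong (e i))) (‼-⊝ ys)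

    ⊝-inverseʳ : ∀ xs → xs ⊕ ⊝ xs ≋ []
    ⊝-inverseʳ xs = ≋-by (λ i → 0#)
      (λ i → trans (‼-⊕≈ xs (⊝ xs) i refl (‼-⊝ xs i)) (-‿inverseʳ _)) (λ i → refl)

    scale-congˡ : ∀ a {xs ys} → xs ≋ ys → scale a xs ≋ scale a ys
    scale-congˡ a {xs} {ys} (coeffwise e) = ≋-by (λ i → a * ys ‼ i)
      (λ i → trans (‼-scale a xs i) (*-congˡ (e i))) (‼-scale a ys)

    scale-congʳ : ∀ {a b} xs → a ≈ b → scale a xs ≋ scale b xs
    scale-congʳ {a} {b} xs e = ≋-by (λ i → b * xs ‼ i)
      (λ i → trans (‼-scale a xs i) (*-congʳ e)) (‼-scale b xs)

    scale-zeroˡ : ∀ {a} xs → a ≈ 0# → scale a xs ≋ []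
    scale-zeroˡ {a} xs e = ≋-by (λ i → 0#)
      (λ i → trans (‼-scale a xs i) (trans (*-congʳ e) (zeroˡ _))) (λ i → refl)

    scale-distribˡ : ∀ a xs ys → scale a (xs ⊕ ys) ≋ scale a xs ⊕ scale a ys
    scale-distribˡ a xs ys = ≋-by (λ i → a * xs ‼ i + a * ys ‼ i)
      (λ i → trans (‼-scale a (xs ⊕ ys) i) (trans (*-congˡ (‼-⊕ xs ys i)) (distribˡ _ _ _)))
      (λ i → ‼-⊕≈ (scale a xs) (scale a ys) i (‼-scale a xs i) (‼-scale a ys i))

    scale-distribʳ : ∀ a b xs → scale (a + b) xs ≋ scale a xs ⊕ scale b xs
    scale-distribʳ a b xs = ≋-by (λ i → a * xs ‼ i + b * xs ‼ i)
      (λ i → trans (‼-scale _ xs i) (distribʳ _ _ _))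
      (λ i → ‼-⊕≈ (scale a xs) (scale b xs) i (‼-scale a xs i) (‼-scale b xs i))

    scale-scale : ∀ a b xs → scale a (scale b xs) ≋ scale (a * b) xs
    scale-scale a b xs = ≋-by (λ i → (a * b) * xs ‼ i)
      (λ i → trans (‼-scale a (scale b xs) i) (trans (*-congˡ (‼-scale b xs i)) (sym (*-assoc _ _ _))))
      (‼-scale _ xs)

    scale-identityˡ : ∀ xs → scale 1# xs ≋ xs
    scale-identityˡ xs = ≋-by (xs ‼_) (λ i → trans (‼-scale _ xs i) (*-identityˡ _)) (λ i → refl)

    ⊛-≋[] : ∀ {xs} ys → xs ≋ [] → xs ⊛ ys ≋ []
    ⊛-≋[] {[]}     ys e             = ≋-refl
    ⊛-≋[] {x ∷ xs} ys (coeffwise e) =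
      ⊕-cong (scale-zeroˡ ys (e 0)) (0∷-≋[] (⊛-≋[] {xs} ys (coeffwise (e ∘ suc))))

    ⊛-congʳ : ∀ {xs xs′} ys → xs ≋ xs′ → xs ⊛ ys ≋ xs′ ⊛ ys
    ⊛-congʳ {[]}     {[]}       ys e             = ≋-refl
    ⊛-congʳ {[]}     {x′ ∷ xs′} ys e             = ≋-sym (⊛-≋[] ys (≋-sym e))
    ⊛-congʳ {x ∷ xs} {[]}       ys e             = ⊛-≋[] ys e
    ⊛-congʳ {x ∷ xs} {x′ ∷ xs′} ys (coeffwise e) =
      ⊕-cong (scale-congʳ ys (e 0)) (∷-cong refl (⊛-congʳ {xs} {xs′} ys (coeffwise (e ∘ suc))))

    ⊛-congˡ : ∀ xs {ys ys′} → ys ≋ ys′ → xs ⊛ ys ≋ xs ⊛ ys′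
    ⊛-congˡ []       e = ≋-refl
    ⊛-congˡ (x ∷ xs) e = ⊕-cong (scale-congˡ x e) (∷-cong refl (⊛-congˡ xs e))

    ⊛-zeroʳ : ∀ xs → xs ⊛ [] ≋ []
    ⊛-zeroʳ []       = ≋-refl
    ⊛-zeroʳ (x ∷ xs) = 0∷-≋[] (⊛-zeroʳ xs)

    ⊛-distribʳ : ∀ zs xs ys → (xs ⊕ ys) ⊛ zs ≋ xs ⊛ zs ⊕ ys ⊛ zs
    ⊛-distribʳ zs []       ys       = ≋-refl
    ⊛-distribʳ zs (x ∷ xs) []       = ≋-sym (⊕-identityʳ _)
    ⊛-distribʳ zs (x ∷ xs) (y ∷ ys) = ≋-trans
      (⊕-cong (scale-distribʳ x y zs)
              (∷-cong (sym (+-identityˡ 0#)) (⊛-distribʳ zs xs ys)))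
      (⊕-interchange (scale x zs) (scale y zs) (0# ∷ xs ⊛ zs) (0# ∷ ys ⊛ zs))

    ⊛-∷ : ∀ xs y ys → xs ⊛ (y ∷ ys) ≋ scale y xs ⊕ (0# ∷ xs ⊛ ys)
    ⊛-∷ []       y ys = ≋-sym (0∷-≋[] ≋-refl)
    ⊛-∷ (x ∷ xs) y ys = ≋-trans
      (⊕-cong (≋-refl {scale x (y ∷ ys)}) (∷-cong refl (⊛-∷ xs y ys)))
      (∷-cong (+-congʳ (*-comm x y)) (⊕-left-comm (scale x ys) (scale y xs) (0# ∷ xs ⊛ ys)))

    ⊛-comm : ∀ xs ys → xs ⊛ ys ≋ ys ⊛ xs
    ⊛-comm []       ys = ≋-sym (⊛-zeroʳ ys)
    ⊛-comm (x ∷ xs) ys = ≋-trans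
      (⊕-cong (≋-refl {scale x ys}) (∷-cong refl (⊛-comm xs ys)))
      (≋-sym (⊛-∷ ys x xs))

    scale-⊛ : ∀ a xs ys → scale a xs ⊛ ys ≋ scale a (xs ⊛ ys)
    scale-⊛ a []       ys = ≋-refl
    scale-⊛ a (x ∷ xs) ys = ≋-trans
      (⊕-cong (≋-refl {scale (a * x) ys}) (∷-cong refl (scale-⊛ a xs ys)))
      (≋-sym (≋-trans (scale-distribˡ a (scale x ys) (0# ∷ xs ⊛ ys))
                      (⊕-cong (scale-scale a x ys) (∷-cong (zeroʳ a) ≋-refl))))

    ⊛-assoc : ∀ xs ys zs → (xs ⊛ ys) ⊛ zs ≋ xs ⊛ (ys ⊛ zs)
    ⊛-assoc []       ys zs = ≋-refl
    ⊛-assoc (x ∷ xs) ys zs = ≋-trans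
      (⊛-distribʳ zs (scale x ys) (0# ∷ xs ⊛ ys))
      (⊕-cong (scale-⊛ x ys zs)
              (⊕-cong (scale-zeroˡ zs refl) (∷-cong refl (⊛-assoc xs ys zs))))

    ⊛-identityˡ : ∀ xs → (1# ∷ []) ⊛ xs ≋ xs
    ⊛-identityˡ xs = ≋-trans (⊕-cong (scale-identityˡ xs) (0∷-≋[] ≋-refl)) (⊕-identityʳ xs)

    isCommutativeRing : IsPolyRing (suc k)
    isCommutativeRing = record
      { isRing = record
        { +-isAbelianGroup = record
          { isGroup = record
            { isMonoid = record
              { isSemigroup = CommutativeSemigroup.isSemigroup ⊕-commutativeSemigroup
              ; identity    = (λ xs → ≋-refl) , ⊕-identityʳ }
            ; inverse = (λ xs → ≋-trans (⊕-comm (⊝ xs) xs) (⊝-inverseʳ xs)) , ⊝-inverseʳ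
            ; ⁻¹-cong = ⊝-cong }
          ; comm = ⊕-comm }
        ; *-cong     = λ {xs} {xs′} e f → ≋-trans (⊛-congʳ _ e) (⊛-congˡ xs′ f)
        ; *-assoc    = ⊛-assoc
        ; *-identity = ⊛-identityˡ , λ xs → ≋-trans (⊛-comm xs _) (⊛-identityˡ xs)
        ; distrib    = (λ xs ys zs → ≋-trans (⊛-comm xs _)
                          (≋-trans (⊛-distribʳ xs ys zs) (⊕-cong (⊛-comm ys xs) (⊛-comm zs xs))))
                     , ⊛-distribʳ }
      ; *-comm = ⊛-comm }

  polyIsCommutativeRing : ∀ k → IsPolyRing k
  polyIsCommutativeRing zero    = K.isCommutativeRing
  polyIsCommutativeRing (suc k) = ListRing.isCommutativeRing k (polyIsCommutativeRing k)

  polyRing : ℕ → CommutativeRing c ℓ₁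
  polyRing k = record { isCommutativeRing = polyIsCommutativeRing k }

  module L (k : ℕ) = ListRing k (polyIsCommutativeRing k)
  module P (k : ℕ) = CommutativeRing (polyRing k)

  constP-cong : ∀ k {a b} → a K.≈ b → Eq k (constP k a) (constP k b)
  constP-cong zero    e = e
  constP-cong (suc k) e = L.∷-cong k (constP-cong k e) (L.≋-refl k)

  constP-0# : ∀ k → Eq k (constP k K.0#) (zeroP k)
  constP-0# zero    = K.refl
  constP-0# (suc k) = coeffwise λ { zero → constP-0# k ; (suc i) → P.refl k }

  constP-+ : ∀ k a b → Eq k (constP k (a K.+ b)) (addP k (constP k a) (constP k b))
  constP-+ zero    a b = K.refl
  constP-+ (suc k) a b = L.∷-cong k (constP-+ k a b) (L.≋-refl k)

  constP-neg : ∀ k a → Eq k (constP k (K.- a)) (negP k (constP k a))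
  constP-neg zero    a = K.refl
  constP-neg (suc k) a = L.∷-cong k (constP-neg k a) (L.≋-refl k)

  constP-* : ∀ k a b → Eq k (constP k (a K.* b)) (mulP k (constP k a) (constP k b))
  constP-* zero    a b = K.refl
  constP-* (suc k) a b =
    L.∷-cong k (P.trans k (constP-* k a b) (P.sym k (P.+-identityʳ k _))) (L.≋-refl k)

  private module ≤ = IsTotalOrder K.isTotalOrder

  -- If 1 ≤ 0 then 0 ≤ -1, and 1 = (-1)(-1) is a product of nonnegatives.
  0≤1# : K.0# K.≤ K.1#
  0≤1# with ≤.total K.0# K.1#
  ... | inj₁ 0≤1 = 0≤1
  ... | inj₂ 1≤0 =
    ≤.≲-respʳ-≈ (K.trans (-1*x≈-x (K.- K.1#)) (-‿involutive K.1#)) (K.*-nonneg 0≤-1 0≤-1)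
    where
    open RingProperties K.ring using (-1*x≈-x; -‿involutive)
    0≤-1 : K.0# K.≤ (K.- K.1#)
    0≤-1 = ≤.≲-respʳ-≈ (K.+-identityˡ _)
             (≤.≲-respˡ-≈ (K.-‿inverseʳ _) (K.+-monoˡ-≤ (K.- K.1#) 1≤0))

  nonNeg-zeroP : ∀ k → NonNeg k (zeroP k)
  nonNeg-zeroP zero    = lift ≤.refl
  nonNeg-zeroP (suc k) = []

  nonNeg-resp : ∀ k {x y} → Eq k x y → NonNeg k x → NonNeg k y
  nonNeg-resp zero    e (lift p) = lift (≤.≲-respʳ-≈ e p)
  nonNeg-resp (suc k) {xs} {ys} e = go xs ys e
    where
    go : ∀ xs ys → Eq (suc k) xs ys → NonNeg (suc k) xs → NonNeg (suc k) ys
    go xs       []       e             p        = []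
    go []       (y ∷ ys) (coeffwise e) p        =
      nonNeg-resp k (e 0) (nonNeg-zeroP k) ∷ go [] ys (coeffwise (e ∘ suc)) []
    go (x ∷ xs) (y ∷ ys) (coeffwise e) (px ∷ p) =
      nonNeg-resp k (e 0) px ∷ go xs ys (coeffwise (e ∘ suc)) p

  nonNeg-+ : ∀ k {x y} → NonNeg k x → NonNeg k y → NonNeg k (addP k x y)
  nonNeg-+ zero    (lift p) (lift q) = lift (≤.trans q (≤.≲-respˡ-≈ (K.+-identityˡ _) (K.+-monoˡ-≤ _ p)))
  nonNeg-+ (suc k) {[]}              p        q        = q
  nonNeg-+ (suc k) {x ∷ xs} {[]}     p        q        = p
  nonNeg-+ (suc k) {x ∷ xs} {y ∷ ys} (px ∷ p) (qy ∷ q) = nonNeg-+ k px qy ∷ nonNeg-+ (suc k) p q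

  nonNeg-* : ∀ k {x y} → NonNeg k x → NonNeg k y → NonNeg k (mulP k x y)
  nonNeg-scale : ∀ k {x ys} → NonNeg k x → NonNeg (suc k) ys → NonNeg (suc k) (scaleP k x ys)
  nonNeg-* zero    (lift p) (lift q) = lift (K.*-nonneg p q)
  nonNeg-* (suc k) {[]}     p        q = []
  nonNeg-* (suc k) {x ∷ xs} (px ∷ p) q =
    nonNeg-+ (suc k) (nonNeg-scale k px q) (nonNeg-zeroP k ∷ nonNeg-* (suc k) p q)
  nonNeg-scale k {ys = []}     px q        = []
  nonNeg-scale k {ys = y ∷ ys} px (qy ∷ q) = nonNeg-* k px qy ∷ nonNeg-scale k px q

  nonNeg-constP : ∀ k {a} → K.0# K.≤ a → NonNeg k (constP k a)
  nonNeg-constP zero    p = lift p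
  nonNeg-constP (suc k) p = nonNeg-constP k p ∷ []

  nonNeg-var : ∀ k i → NonNeg k (var k i)
  nonNeg-var (suc k) zero    = nonNeg-zeroP k ∷ nonNeg-constP k 0≤1# ∷ []
  nonNeg-var (suc k) (suc i) = nonNeg-var k i ∷ []

  nonNeg-powP : ∀ k {x} n → NonNeg k x → NonNeg k (powP k x n)
  nonNeg-powP k zero    p = nonNeg-constP k 0≤1#
  nonNeg-powP k (suc n) p = nonNeg-* k p (nonNeg-powP k n p)

  DegreeAtMost : ℕ → Poly 1 → Set ℓ₁
  DegreeAtMost N       []       = ⊤
  DegreeAtMost zero    (p ∷ ps) = Eq 1 ps []
  DegreeAtMost (suc N) (p ∷ ps) = DegreeAtMost N ps

  degree-≋[] : ∀ N {P} → Eq 1 P [] → DegreeAtMost N P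
  degree-≋[] N       {[]}     e             = tt
  degree-≋[] zero    {p ∷ ps} (coeffwise e) = coeffwise (e ∘ suc)
  degree-≋[] (suc N) {p ∷ ps} (coeffwise e) = degree-≋[] N {ps} (coeffwise (e ∘ suc))

  degree-suc : ∀ N P → DegreeAtMost N P → DegreeAtMost (suc N) P
  degree-suc N       []       d = tt
  degree-suc zero    (p ∷ ps) d = degree-≋[] 0 d
  degree-suc (suc N) (p ∷ ps) d = degree-suc N ps d

  degree-raise : ∀ M {N} P → DegreeAtMost N P → DegreeAtMost (M ℕ.+ N) P
  degree-raise zero    P d = d
  degree-raise (suc M) P d = degree-suc _ P (degree-raise M P d)

  degree-+ : ∀ N P Q → DegreeAtMost N P → DegreeAtMost N Q → DegreeAtMost N (addP 1 P Q)
  degree-+ N       []       Q        dp dq = dq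
  degree-+ N       (p ∷ ps) []       dp dq = dp
  degree-+ zero    (p ∷ ps) (q ∷ qs) dp dq = L.⊕-cong 0 dp dq
  degree-+ (suc N) (p ∷ ps) (q ∷ qs) dp dq = degree-+ N ps qs dp dq

  degree-neg : ∀ N P → DegreeAtMost N P → DegreeAtMost N (negP 1 P)
  degree-neg N       []       d = tt
  degree-neg zero    (p ∷ ps) d = L.⊝-cong 0 d
  degree-neg (suc N) (p ∷ ps) d = degree-neg N ps d

  degree-scale : ∀ N a Q → DegreeAtMost N Q → DegreeAtMost N (scaleP 0 a Q)
  degree-scale N       a []       d = tt
  degree-scale zero    a (q ∷ qs) d = L.scale-congˡ 0 a d
  degree-scale (suc N) a (q ∷ qs) d = degree-scale N a qs d

  degree-∷ : ∀ N x {ps} → Eq 1 ps [] → DegreeAtMost N (x ∷ ps)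
  degree-∷ zero    x e = e
  degree-∷ (suc N) x e = degree-≋[] N e

  degree-* : ∀ N M P Q → DegreeAtMost N P → DegreeAtMost M Q → DegreeAtMost (N ℕ.+ M) (mulP 1 P Q)
  degree-* N       M []       Q dp dq = tt
  degree-* zero    M (p ∷ ps) Q dp dq =
    degree-+ M (scaleP 0 p Q) (K.0# ∷ mulP 1 ps Q)
      (degree-scale M p Q dq) (degree-∷ M K.0# (L.⊛-≋[] 0 Q dp))
  degree-* (suc N) M (p ∷ ps) Q dp dq =
    degree-+ (suc (N ℕ.+ M)) (scaleP 0 p Q) (K.0# ∷ mulP 1 ps Q)
      (degree-raise (suc N) (scaleP 0 p Q) (degree-scale M p Q dq)) (degree-* N M ps Q dp dq)

  degree-sumFin : ∀ N m (f : Fin m → Poly 1) → (∀ i → DegreeAtMost N (f i)) → DegreeAtMost N (sumFin 1 m f)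
  degree-sumFin N zero    f d = tt
  degree-sumFin N (suc m) f d = degree-+ N (f zero) _ (d zero) (degree-sumFin N m (f ∘ suc) (d ∘ suc))

  degree-altSign : ∀ N n P → DegreeAtMost N P → DegreeAtMost N (altSign 1 n P)
  degree-altSign N zero    P d = d
  degree-altSign N (suc n) P d = degree-neg N (altSign 1 n P) (degree-altSign N n P d)

  ≋[]-from-coeff : ∀ ps → (∀ j → coeff ps j K.≈ K.0#) → Eq 1 ps []
  ≋[]-from-coeff []       f = coeffwise λ _ → K.refl
  ≋[]-from-coeff (p ∷ ps) f = coeffwise λ
    { zero    → f 0
    ; (suc j) → coeff-∼ (≋[]-from-coeff ps (f ∘ suc)) j }

  degree-from-coeff : ∀ N P → (∀ j → N ℕ.< j → coeff P j K.≈ K.0#) → DegreeAtMost N P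
  degree-from-coeff N       []       f = tt
  degree-from-coeff zero    (p ∷ ps) f = ≋[]-from-coeff ps (λ j → f (suc j) (ℕ.s≤s ℕ.z≤n))
  degree-from-coeff (suc N) (p ∷ ps) f = degree-from-coeff N ps (λ j → f (suc j) ∘ ℕ.s≤s)

  minor : ∀ {m} {A : Set c} → (Fin (suc m) → Fin (suc m) → A) → Fin (suc m) → Fin m → Fin m → A
  minor M j r s = M (suc r) (punchIn j s)

  cofactorTerm : ∀ k {m} → (Fin (suc m) → Fin (suc m) → Poly k) → Fin (suc m) → Poly k
  cofactorTerm k {m} M j = mulP k (M zero j) (det k m (minor M j))

  laplace-weight : ∀ {m} (u v : Fin (suc m) → ℕ) j →
    (u zero ℕ.+ v j) ℕ.+ (sum (u ∘ suc) ℕ.+ sum (removeAt v j)) ≡ sum u ℕ.+ sum v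
  laplace-weight u v j = ≡.trans (+-interchange (u zero) (v j) (sum (u ∘ suc)) (sum (removeAt v j)))
                                 (≡.cong (sum u ℕ.+_) (≡.sym (sum-remove v)))

  det-degree : ∀ m (B : Fin m → Fin m → Poly 1) (u v : Fin m → ℕ) →
    (∀ s t → DegreeAtMost (u s ℕ.+ v t) (B s t)) → DegreeAtMost (sum u ℕ.+ sum v) (det 1 m B)
  det-degree zero    B u v d = L.≋-refl 0
  det-degree (suc m) B u v d =
    degree-sumFin _ (suc m) (λ j → altSign 1 (toℕ j) (cofactorTerm 1 B j)) λ j →
    degree-altSign _ (toℕ j) _ (≡.subst (λ n → DegreeAtMost n (cofactorTerm 1 B j)) (laplace-weight u v j)
      (degree-* _ _ (B zero j) _ (d zero j)
        (det-degree m (minor B j) (u ∘ suc) (removeAt v j) λ r s → d (suc r) (punchIn j s))))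

  module _ (k : ℕ) where
    open CommutativeRing (polyRing k) hiding (zero)

    sumFin-cong : ∀ m {f g : Fin m → Poly k} → (∀ i → f i ≈ g i) → sumFin k m f ≈ sumFin k m g
    sumFin-cong zero    e = refl
    sumFin-cong (suc m) e = +-cong (e zero) (sumFin-cong m (e ∘ suc))

    sumFin-zeroP : ∀ m → sumFin k m (λ _ → 0#) ≈ 0#
    sumFin-zeroP zero    = refl
    sumFin-zeroP (suc m) = trans (+-identityˡ _) (sumFin-zeroP m)

    *-distribˡ-sumFin : ∀ m x (f : Fin m → Poly k) → sumFin k m (λ i → x * f i) ≈ x * sumFin k m f
    *-distribˡ-sumFin zero    x f = sym (zeroʳ x)
    *-distribˡ-sumFin (suc m) x f =
      trans (+-congˡ (*-distribˡ-sumFin m x (f ∘ suc))) (sym (distribˡ x _ _))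

    altSign-cong : ∀ n {x y} → x ≈ y → altSign k n x ≈ altSign k n y
    altSign-cong zero    e = e
    altSign-cong (suc n) e = -‿cong (altSign-cong n e)

    det-cong : ∀ m {M M′ : Fin m → Fin m → Poly k} →
      (∀ s t → M s t ≈ M′ s t) → det k m M ≈ det k m M′
    det-cong zero    e = refl
    det-cong (suc m) e = sumFin-cong (suc m) λ j →
      altSign-cong (toℕ j) (*-cong (e zero j) (det-cong m λ r s → e (suc r) (punchIn j s)))

  module Homogenisation (k : ℕ) (X Y : Poly k) where
    open CommutativeRing (polyRing k) hiding (zero)
    open RingProperties ring using (-0#≈0#; -‿distribˡ-*; -‿distribʳ-*; -‿+-comm)
    open Algebra.Solver.Ring.NaturalCoefficients.Default commutativeSemiring
    open ≈-Reasoning setoid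

    _^_ : Poly k → ℕ → Poly k
    _^_ = powP k

    -- homogenise N P = Σᵢ pᵢ Yⁱ X^(N ∸ i), i.e. X^N P(Y/X) when deg P ≤ N;
    -- coefficients beyond degree N are silently dropped.
    homogenise : ℕ → Poly 1 → Poly k
    homogenise N       []       = 0#
    homogenise zero    (p ∷ ps) = constP k p
    homogenise (suc N) (p ∷ ps) = constP k p * X ^ suc N + Y * homogenise N ps

    homogenise-≋[] : ∀ N {P} → Eq 1 P [] → homogenise N P ≈ 0#
    homogenise-≋[] N       {[]}     e             = refl
    homogenise-≋[] zero    {p ∷ ps} (coeffwise e) = trans (constP-cong k (e 0)) (constP-0# k)
    homogenise-≋[] (suc N) {p ∷ ps} (coeffwise e) = begin
      constP k p * X ^ suc N + Y * homogenise N ps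
        ≈⟨ +-cong (*-congʳ (trans (constP-cong k (e 0)) (constP-0# k)))
                  (*-congˡ (homogenise-≋[] N {ps} (coeffwise (e ∘ suc)))) ⟩
      0# * X ^ suc N + Y * 0#
        ≈⟨ trans (+-cong (zeroˡ _) (zeroʳ Y)) (+-identityˡ 0#) ⟩
      0# ∎

    homogenise-cong : ∀ N {P Q} → Eq 1 P Q → homogenise N P ≈ homogenise N Q
    homogenise-cong N       {[]}     {[]}     e             = refl
    homogenise-cong N       {[]}     {q ∷ qs} e             = sym (homogenise-≋[] N (L.≋-sym 0 e))
    homogenise-cong N       {p ∷ ps} {[]}     e             = homogenise-≋[] N e
    homogenise-cong zero    {p ∷ ps} {q ∷ qs} (coeffwise e) = constP-cong k (e 0)
    homogenise-cong (suc N) {p ∷ ps} {q ∷ qs} (coeffwise e) =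
      +-cong (*-congʳ (constP-cong k (e 0))) (*-congˡ (homogenise-cong N {ps} {qs} (coeffwise (e ∘ suc))))

    homogenise-+ : ∀ N P Q → homogenise N (addP 1 P Q) ≈ homogenise N P + homogenise N Q
    homogenise-+ N       []       Q        = sym (+-identityˡ _)
    homogenise-+ N       (p ∷ ps) []       = sym (+-identityʳ _)
    homogenise-+ zero    (p ∷ ps) (q ∷ qs) = constP-+ k p q
    homogenise-+ (suc N) (p ∷ ps) (q ∷ qs) = begin
      constP k (p K.+ q) * X ^ suc N + Y * homogenise N (addP 1 ps qs)
        ≈⟨ +-cong (*-congʳ (constP-+ k p q)) (*-congˡ (homogenise-+ N ps qs)) ⟩
      (constP k p + constP k q) * X ^ suc N + Y * (homogenise N ps + homogenise N qs)
        ≈⟨ solve 6 (λ a b x y u v → (a :+ b) :* x :+ y :* (u :+ v) := (a :* x :+ y :* u) :+ (b :* x :+ y :* v))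
                 refl _ _ _ _ _ _ ⟩
      (constP k p * X ^ suc N + Y * homogenise N ps) + (constP k q * X ^ suc N + Y * homogenise N qs) ∎

    homogenise-neg : ∀ N P → homogenise N (negP 1 P) ≈ - homogenise N P
    homogenise-neg N       []       = sym -0#≈0#
    homogenise-neg zero    (p ∷ ps) = constP-neg k p
    homogenise-neg (suc N) (p ∷ ps) = begin
      constP k (K.- p) * X ^ suc N + Y * homogenise N (negP 1 ps)
        ≈⟨ +-cong (*-congʳ (constP-neg k p)) (*-congˡ (homogenise-neg N ps)) ⟩
      - constP k p * X ^ suc N + Y * - homogenise N ps
        ≈⟨ +-cong (sym (-‿distribˡ-* _ _)) (sym (-‿distribʳ-* _ _)) ⟩
      - (constP k p * X ^ suc N) + - (Y * homogenise N ps)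
        ≈⟨ -‿+-comm _ _ ⟩
      - (constP k p * X ^ suc N + Y * homogenise N ps) ∎

    homogenise-scale : ∀ N a Q → homogenise N (scaleP 0 a Q) ≈ constP k a * homogenise N Q
    homogenise-scale N       a []       = sym (zeroʳ _)
    homogenise-scale zero    a (q ∷ qs) = constP-* k a q
    homogenise-scale (suc N) a (q ∷ qs) = begin
      constP k (a K.* q) * X ^ suc N + Y * homogenise N (scaleP 0 a qs)
        ≈⟨ +-cong (*-congʳ (constP-* k a q)) (*-congˡ (homogenise-scale N a qs)) ⟩
      (constP k a * constP k q) * X ^ suc N + Y * (constP k a * homogenise N qs)
        ≈⟨ solve 5 (λ a b x y u → (a :* b) :* x :+ y :* (a :* u) := a :* (b :* x :+ y :* u)) refl _ _ _ _ _ ⟩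
      constP k a * (constP k q * X ^ suc N + Y * homogenise N qs) ∎

    homogenise-0∷ : ∀ N P → homogenise (suc N) (K.0# ∷ P) ≈ Y * homogenise N P
    homogenise-0∷ N P = trans (+-congʳ (trans (*-congʳ (constP-0# k)) (zeroˡ _))) (+-identityˡ _)

    homogenise-suc : ∀ N Q → DegreeAtMost N Q → homogenise (suc N) Q ≈ X * homogenise N Q
    homogenise-suc N       []       d = sym (zeroʳ X)
    homogenise-suc zero    (q ∷ qs) d = begin
      constP k q * (X * 1#) + Y * homogenise 0 qs
        ≈⟨ +-cong (*-congˡ (*-identityʳ X)) (*-congˡ (homogenise-≋[] 0 d)) ⟩
      constP k q * X + Y * 0#
        ≈⟨ solve 3 (λ a x y → a :* x :+ y :* con 0 := x :* a) refl _ _ _ ⟩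
      X * constP k q ∎
    homogenise-suc (suc N) (q ∷ qs) d = begin
      constP k q * X ^ suc (suc N) + Y * homogenise (suc N) qs
        ≈⟨ +-congˡ (*-congˡ (homogenise-suc N qs d)) ⟩
      constP k q * (X * X ^ suc N) + Y * (X * homogenise N qs)
        ≈⟨ solve 5 (λ a x z y u → a :* (x :* z) :+ y :* (x :* u) := x :* (a :* z :+ y :* u)) refl _ _ _ _ _ ⟩
      X * (constP k q * X ^ suc N + Y * homogenise N qs) ∎

    homogenise-raise : ∀ M N Q → DegreeAtMost N Q → homogenise (M ℕ.+ N) Q ≈ X ^ M * homogenise N Q
    homogenise-raise zero    N Q d = sym (*-identityˡ _)
    homogenise-raise (suc M) N Q d = begin
      homogenise (suc (M ℕ.+ N)) Q ≈⟨ homogenise-suc (M ℕ.+ N) Q (degree-raise M Q d) ⟩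
      X * homogenise (M ℕ.+ N) Q   ≈⟨ *-congˡ (homogenise-raise M N Q d) ⟩
      X * (X ^ M * homogenise N Q) ≈⟨ sym (*-assoc _ _ _) ⟩
      X ^ suc M * homogenise N Q   ∎

    homogenise-* : ∀ N M P Q → DegreeAtMost N P → DegreeAtMost M Q →
      homogenise (N ℕ.+ M) (mulP 1 P Q) ≈ homogenise N P * homogenise M Q
    homogenise-* N       M []       Q dp dq = sym (zeroˡ _)
    homogenise-* zero    M (p ∷ ps) Q dp dq = begin
      homogenise M (addP 1 (scaleP 0 p Q) (K.0# ∷ mulP 1 ps Q))
        ≈⟨ homogenise-+ M (scaleP 0 p Q) (K.0# ∷ mulP 1 ps Q) ⟩
      homogenise M (scaleP 0 p Q) + homogenise M (K.0# ∷ mulP 1 ps Q)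
        ≈⟨ +-cong (homogenise-scale M p Q) (homogenise-≋[] M (L.0∷-≋[] 0 (L.⊛-≋[] 0 Q dp))) ⟩
      constP k p * homogenise M Q + 0#
        ≈⟨ +-identityʳ _ ⟩
      constP k p * homogenise M Q ∎
    homogenise-* (suc N) M (p ∷ ps) Q dp dq = begin
      homogenise (suc (N ℕ.+ M)) (addP 1 (scaleP 0 p Q) (K.0# ∷ mulP 1 ps Q))
        ≈⟨ homogenise-+ (suc (N ℕ.+ M)) (scaleP 0 p Q) (K.0# ∷ mulP 1 ps Q) ⟩
      homogenise (suc N ℕ.+ M) (scaleP 0 p Q) + homogenise (suc (N ℕ.+ M)) (K.0# ∷ mulP 1 ps Q)
        ≈⟨ +-cong (trans (homogenise-raise (suc N) M (scaleP 0 p Q) (degree-scale M p Q dq))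
                         (*-congˡ (homogenise-scale M p Q)))
                  (trans (homogenise-0∷ (N ℕ.+ M) (mulP 1 ps Q)) (*-congˡ (homogenise-* N M ps Q dp dq))) ⟩
      X ^ suc N * (constP k p * homogenise M Q) + Y * (homogenise N ps * homogenise M Q)
        ≈⟨ solve 5 (λ x a q y h → x :* (a :* q) :+ y :* (h :* q) := (a :* x :+ y :* h) :* q) refl _ _ _ _ _ ⟩
      (constP k p * X ^ suc N + Y * homogenise N ps) * homogenise M Q ∎

    homogenise-sumFin : ∀ N m (f : Fin m → Poly 1) →
      homogenise N (sumFin 1 m f) ≈ sumFin k m (homogenise N ∘ f)
    homogenise-sumFin N zero    f = refl
    homogenise-sumFin N (suc m) f =
      trans (homogenise-+ N (f zero) _) (+-congˡ (homogenise-sumFin N m (f ∘ suc)))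

    homogenise-altSign : ∀ N n P → homogenise N (altSign 1 n P) ≈ altSign k n (homogenise N P)
    homogenise-altSign N zero    P = refl
    homogenise-altSign N (suc n) P = trans (homogenise-neg N (altSign 1 n P)) (-‿cong (homogenise-altSign N n P))

    homogenise-nonNeg : NonNeg k X → NonNeg k Y → ∀ N P → NonNeg 1 P → NonNeg k (homogenise N P)
    homogenise-nonNeg X≥0 Y≥0 N       []       P≥0               = nonNeg-zeroP k
    homogenise-nonNeg X≥0 Y≥0 zero    (p ∷ ps) (lift p≥0 ∷ ps≥0) = nonNeg-constP k p≥0
    homogenise-nonNeg X≥0 Y≥0 (suc N) (p ∷ ps) (lift p≥0 ∷ ps≥0) =
      nonNeg-+ k (nonNeg-* k (nonNeg-constP k p≥0) (nonNeg-powP k (suc N) X≥0))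
                 (nonNeg-* k Y≥0 (homogenise-nonNeg X≥0 Y≥0 N ps ps≥0))

    expansionTerm : ℕ → Poly 1 → ℕ → Poly k
    expansionTerm N P i = constP k (coeff P i) * (Y ^ i * X ^ (N ∸ i))

    homogenise-expansion : ∀ N P → sumFin k (suc N) (expansionTerm N P ∘ toℕ) ≈ homogenise N P
    homogenise-expansion N [] = trans
      (sumFin-cong k (suc N) {g = λ _ → 0#} λ i →
        trans (*-congʳ (constP-0# k)) (zeroˡ (Y ^ toℕ i * X ^ (N ∸ toℕ i))))
      (sumFin-zeroP k (suc N))
    homogenise-expansion zero (p ∷ ps) =
      solve 1 (λ a → a :* (con 1 :* con 1) :+ con 0 := a) refl (constP k p)
    homogenise-expansion (suc N) (p ∷ ps) = +-cong (*-congˡ (*-identityˡ _)) (begin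
      sumFin k (suc N) (λ i → expansionTerm (suc N) (p ∷ ps) (suc (toℕ i)))
        ≈⟨ sumFin-cong k (suc N) (λ i → solve 4 (λ a y z x → a :* (y :* z :* x) := y :* (a :* (z :* x)))
             refl (constP k (coeff ps (toℕ i))) Y (Y ^ toℕ i) (X ^ (N ∸ toℕ i))) ⟩
      sumFin k (suc N) (λ i → Y * expansionTerm N ps (toℕ i))
        ≈⟨ *-distribˡ-sumFin k (suc N) Y (expansionTerm N ps ∘ toℕ) ⟩
      Y * sumFin k (suc N) (expansionTerm N ps ∘ toℕ)
        ≈⟨ *-congˡ (homogenise-expansion N ps) ⟩
      Y * homogenise N ps ∎)

    det-homogenise : ∀ m (B : Fin m → Fin m → Poly 1) (u v : Fin m → ℕ) →
      (∀ s t → DegreeAtMost (u s ℕ.+ v t) (B s t)) →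
      det k m (λ s t → homogenise (u s ℕ.+ v t) (B s t)) ≈ homogenise (sum u ℕ.+ sum v) (det 1 m B)
    det-homogenise zero    B u v d = refl
    det-homogenise (suc m) B u v d = begin
      sumFin k (suc m) (λ j → altSign k (toℕ j) (M zero j * det k m (minor M j)))
        ≈⟨ sumFin-cong k (suc m) (λ j → altSign-cong k (toℕ j) (expand j)) ⟩
      sumFin k (suc m) (λ j → altSign k (toℕ j) (homogenise T (cofactorTerm 1 B j)))
        ≈⟨ sumFin-cong k (suc m) (λ j → sym (homogenise-altSign T (toℕ j) (cofactorTerm 1 B j))) ⟩
      sumFin k (suc m) (λ j → homogenise T (altSign 1 (toℕ j) (cofactorTerm 1 B j)))
        ≈⟨ sym (homogenise-sumFin T (suc m) λ j → altSign 1 (toℕ j) (cofactorTerm 1 B j)) ⟩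
      homogenise T (det 1 (suc m) B) ∎
      where
      M : Fin (suc m) → Fin (suc m) → Poly k
      M s t = homogenise (u s ℕ.+ v t) (B s t)
      T : ℕ
      T = sum u ℕ.+ sum v
      minor-d : ∀ j r s → DegreeAtMost (u (suc r) ℕ.+ removeAt v j s) (minor B j r s)
      minor-d j r s = d (suc r) (punchIn j s)
      expand : ∀ j → M zero j * det k m (minor M j) ≈ homogenise T (cofactorTerm 1 B j)
      expand j = begin
        M zero j * det k m (minor M j)
          ≈⟨ *-congˡ (det-homogenise m (minor B j) (u ∘ suc) (removeAt v j) (minor-d j)) ⟩
        M zero j * homogenise (sum (u ∘ suc) ℕ.+ sum (removeAt v j)) (det 1 m (minor B j))
          ≈⟨ sym (homogenise-* _ _ (B zero j) _ (d zero j)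
                   (det-degree m (minor B j) (u ∘ suc) (removeAt v j) (minor-d j))) ⟩
        homogenise ((u zero ℕ.+ v j) ℕ.+ (sum (u ∘ suc) ℕ.+ sum (removeAt v j))) (cofactorTerm 1 B j)
          ≡⟨ ≡.cong (λ n → homogenise n (cofactorTerm 1 B j)) (laplace-weight u v j) ⟩
        homogenise T (cofactorTerm 1 B j) ∎

  a+bq c+dq : Poly 5
  a+bq = addP 5 (var 5 0F) (mulP 5 (var 5 1F) (var 5 4F))
  c+dq = addP 5 (var 5 2F) (mulP 5 (var 5 3F) (var 5 4F))

  nonNeg-a+bq : NonNeg 5 a+bq
  nonNeg-a+bq = nonNeg-+ 5 (nonNeg-var 5 0F) (nonNeg-* 5 (nonNeg-var 5 1F) (nonNeg-var 5 4F))

  nonNeg-c+dq : NonNeg 5 c+dq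
  nonNeg-c+dq = nonNeg-+ 5 (nonNeg-var 5 2F) (nonNeg-* 5 (nonNeg-var 5 3F) (nonNeg-var 5 4F))

  module Hat = Homogenisation 5 a+bq c+dq
  open Hat using (homogenise; homogenise-expansion; det-homogenise)

  -- hat A n unfolds to the left-hand side of homogenise-expansion.
  hankel-minor-hat : (A : ℕ → Poly 1) → (∀ n → DegreeAtMost n (A n)) → ∀ m (I J : Fin m → ℕ) →
    Eq 5 (det 5 m (λ s t → hat A (I s ℕ.+ J t)))
         (homogenise (sum I ℕ.+ sum J) (det 1 m (λ s t → A (I s ℕ.+ J t))))
  hankel-minor-hat A deg≤ m I J = P.trans 5
    (det-cong 5 m (λ s t → homogenise-expansion (I s ℕ.+ J t) (A (I s ℕ.+ J t))))
    (det-homogenise m (λ s t → A (I s ℕ.+ J t)) I J (λ s t → deg≤ (I s ℕ.+ J t)))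

proposition1p8 : ∀ {c ℓ₁ ℓ₂ : Level} (O : OrderedCommRing c ℓ₁ ℓ₂) (r : ℕ)
    (A : ℕ → Poly.Poly O 1) →
    (∀ n → Poly.HasDegree O n (A n)) →
    Poly.HankelTP O 1 r A →
    Poly.HankelTP O 5 r (Poly.hat O A)
proposition1p8 O r A hasDegree hankelTP m m≤r I J I↑ J↑ =
  nonNeg-resp O 5 (P.sym O 5 (hankel-minor-hat O A deg≤ m I J))
    (Hat.homogenise-nonNeg O (nonNeg-a+bq O) (nonNeg-c+dq O) _ _ (hankelTP m m≤r I J I↑ J↑))
  where
  deg≤ : ∀ n → DegreeAtMost O n (A n)
  deg≤ n = degree-from-coeff O n (A n) (proj₁ (hasDegree n))
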